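{- Let $G$ be a connected graph with $n$ vertices and suppose $\{w_1,w_2\}$ is a $2$-separator of $G$. Let $C$ be the vertex set of a connected component of $G - \{w_1,w_2\}$ with $|C| \leq \frac{n-2}{2}$, and let $v \in C$. Then there is no $u \in V(G)$ such that (1) $\mathrm{dist}(u,v) \leq 2$, (2) $\chi_G(u,u) = \chi_G(v,v)$, and (3) $\mathrm{dist}(u,w_i) \leq \mathrm{dist}(v,w_i)-2$ for both $i \in \{1,2\}$.
   Context: All graphs are finite, simple and undirected; $\mathrm{dist}$ is graph distance. A 2-separator is a set $S$ of two vertices such that $G-S$ has more connected components than $G$. The 2-dimensional Weisfeiler-Leman algorithm: $\chi^0(v_1,v_2)=\chi^0(w_1,w_2)$ iff ($v_1=v_2 \Leftrightarrow w_1=w_2$) and ($v_1v_2\in E\Leftrightarrow w_1w_2\in E$); $\chi^{r+1}(v_1,v_2) = \big(\chi^r(v_1,v_2), \{\!\{(\chi^r(w,v_2),\chi^r(v_1,w)) \mid w \in V(G)\}\!\}\big)$; $\chi_G$ is the stable coloring, i.e. $\chi^r$ for the minimal $r$ such that $\chi^{r+1}$ induces no strictly finer partition than $\chi^r$. -}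

module Defs where

open import Data.Nat using (ℕ; zero; suc; _+_; _<_; _≤_)
open import Data.Fin using (Fin)
open import Data.Fin.Subset using (Subset; _∈_; _∉_)
open import Data.Bool using (Bool; true; false)
open import Data.Product using (Σ; ∃; _×_; _,_; proj₁)
open import Data.Unit using (⊤)
open import Relation.Binary.PropositionalEquality using (_≡_; _≢_)
open import Relation.Nullary using (¬_)
open import Function.Bundles using (_↔_; _⇔_; Inverse)

record Graph (n : ℕ) : Set where
  field
    adj     : Fin n → Fin n → Bool
    sym     : ∀ x y → adj x y ≡ adj y x
    irrefl  : ∀ x → adj x x ≡ false
open Graph public

-- Walks of length k from x to y using only vertices satisfying P
-- (P = "all vertices" gives walks in G; P = "not in S" gives walks in G - S).
data Walk {n : ℕ} (G : Graph n) (P : Fin n → Set) : Fin n → Fin n → ℕ → Set where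
  nil  : ∀ {x} → P x → Walk G P x x zero
  cons : ∀ {x z y k} → P x → adj G x z ≡ true → Walk G P z y k → Walk G P x y (suc k)

allV : {n : ℕ} → Fin n → Set
allV _ = ⊤

notIn : {n : ℕ} → Fin n → Fin n → Fin n → Set
notIn w₁ w₂ x = (x ≢ w₁) × (x ≢ w₂)

Reach : {n : ℕ} → Graph n → (Fin n → Set) → Fin n → Fin n → Set
Reach G P x y = ∃ λ k → Walk G P x y k

Connected : {n : ℕ} → Graph n → Set
Connected G = ∀ x y → Reach G allV x y

IsDist : {n : ℕ} → Graph n → Fin n → Fin n → ℕ → Set
IsDist G u v d = Walk G allV u v d × (∀ k → Walk G allV u v k → d ≤ k)

-- The induced subgraph of G on the vertices satisfying P has exactly c
-- connected components: there is a surjection from its vertices onto Fin c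
-- whose fibres are exactly the classes of the reachability relation.
NumComponents : {n : ℕ} → Graph n → (Fin n → Set) → ℕ → Set
NumComponents {n} G P c =
  Σ ((x : Fin n) → P x → Fin c) λ f →
    (∀ i → ∃ λ x → Σ (P x) λ p → f x p ≡ i) ×
    (∀ x p y q → (f x p ≡ f y q) ⇔ Reach G P x y)

TwoSeparator : {n : ℕ} → Graph n → Fin n → Fin n → Set
TwoSeparator G w₁ w₂ =
  (w₁ ≢ w₂) ×
  (∃ λ c → ∃ λ c' → NumComponents G allV c × NumComponents G (notIn w₁ w₂) c' × c < c')

IsComponent : {n : ℕ} → Graph n → (Fin n → Set) → Subset n → Set
IsComponent G P C =
  (∃ λ x → x ∈ C) ×
  (∀ x → x ∈ C → P x) ×
  (∀ x y → x ∈ C → y ∈ C → Reach G P x y) ×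
  (∀ x y → x ∈ C → Reach G P x y → y ∈ C)

-- 2-WL: χ^r(v₁,v₂) = χ^r(w₁,w₂), as a relation on pairs.
-- Atomic type (round 0).
AtomEq : {n : ℕ} → Graph n → Fin n × Fin n → Fin n × Fin n → Set
AtomEq G (v₁ , v₂) (w₁ , w₂) = ((v₁ ≡ v₂) ⇔ (w₁ ≡ w₂)) × (adj G v₁ v₂ ≡ adj G w₁ w₂)

-- Round r+1: previous colours equal and the multisets
-- {{(χ^r(x,v₂), χ^r(v₁,x)) | x}} and {{(χ^r(x,w₂), χ^r(w₁,x)) | x}} coincide,
-- i.e. there is a bijection π of V(G) matching them.
WLEq : {n : ℕ} → Graph n → ℕ → Fin n × Fin n → Fin n × Fin n → Set
WLEq G zero p q = AtomEq G p q
WLEq {n} G (suc r) (v₁ , v₂) (w₁ , w₂) =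
  WLEq G r (v₁ , v₂) (w₁ , w₂) ×
  Σ (Fin n ↔ Fin n) λ π →
    ∀ x → WLEq G r (x , v₂) (Inverse.to π x , w₂) × WLEq G r (v₁ , x) (w₁ , Inverse.to π x)

-- χ^{r+1} induces no strictly finer partition than χ^r
-- (χ^{r+1} always refines χ^r by construction).
NotStrictlyFiner : {n : ℕ} → Graph n → ℕ → Set
NotStrictlyFiner G r = ∀ p q → WLEq G r p q → WLEq G (suc r) p q

StableRound : {n : ℕ} → Graph n → ℕ → Set
StableRound G r = NotStrictlyFiner G r × (∀ r' → r' < r → ¬ NotStrictlyFiner G r')

-- χ_G(p) = χ_G(q) for the stable colouring χ_G = χ^r, r minimal as above.
SameStableColour : {n : ℕ} → Graph n → Fin n × Fin n → Fin n × Fin n → Set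
SameStableColour G p q = ∃ λ r → StableRound G r × WLEq G r p q

-- The stable 2-WL colour of (u, u) determines the multiset of distances from u,
-- so u and v have the same total distance to all vertices.  But u is at most 2
-- farther than v from every vertex of C, while every vertex outside C is reached
-- from v only through w₁ or w₂, so u is at least 2 closer to it.  Summing,
-- 2 (n − |C|) ≤ 2 |C|, contradicting |C| ≤ (n − 2)/2.
module Submission where

open import Defs
open import Data.Nat using (ℕ; _+_; _*_; _≤_)
open import Data.Fin using (Fin)
open import Data.Fin.Subset using (Subset; _∈_; ∣_∣)
open import Data.Product using (Σ; ∃; _×_; _,_; proj₁; proj₂)
open import Relation.Nullary using (¬_; Dec; yes; no)

open import Data.Nat using (zero; suc; _<_; z≤n; s≤s)
open import Data.Nat.Properties
open import Data.Nat.Induction using (<-rec)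
open import Data.Nat.Tactic.RingSolver using (solve-∀)
open import Data.Fin as Fin using (zero; suc; toℕ; fromℕ<)
open import Data.Fin.Properties using (any?; toℕ<n; toℕ-fromℕ<)
open import Data.Fin.Subset using (_∉_)
open import Data.Bool using (true; false; if_then_else_)
import Data.Bool as Bool
open import Data.Unit using (tt)
open import Data.Empty using (⊥-elim)
open import Data.Sum using (_⊎_; inj₁; inj₂)
open import Data.Vec using (_∷_; []; lookup)
open import Data.Vec.Properties using ([]=⇒lookup)
open import Relation.Nullary.Decidable using (_×-dec_; ¬?)
open import Relation.Unary using (Decidable)
open import Relation.Binary.PropositionalEquality
  using (_≡_; refl; trans; cong; subst; subst₂; module ≡-Reasoning)
  renaming (sym to ≡-sym)
open import Function.Bundles using (Inverse; mk⇔; Equivalence)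
import Data.Fin.Permutation as Perm
open import Algebra.Properties.CommutativeMonoid.Sum +-0-commutativeMonoid
  using (sum; sum-cong-≗; sum-permute; ∑-distrib-+)

module Walks {n : ℕ} (G : Graph n) where

  _++ʷ_ : ∀ {x y z a b} → Walk G allV x y a → Walk G allV y z b → Walk G allV x z (a + b)
  nil _        ++ʷ w′ = w′
  cons p e w   ++ʷ w′ = cons p e (w ++ʷ w′)

  walk? : ∀ k x y → Dec (Walk G allV x y k)
  walk? zero x y with x Fin.≟ y
  ... | yes refl = yes (nil tt)
  ... | no x≢y   = no λ { (nil _) → x≢y refl }
  walk? (suc k) x y with any? (λ z → (adj G x z Bool.≟ true) ×-dec walk? k z y)
  ... | yes (z , e , w) = yes (cons tt e w)
  ... | no ¬step        = no λ { (cons _ e w) → ¬step (_ , e , w) }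

  walk⇒isDist : ∀ {x y} L → Walk G allV x y L → ∃ λ d → IsDist G x y d
  walk⇒isDist {x} {y} = <-rec (λ L → Walk G allV x y L → ∃ λ d → IsDist G x y d) step
    where
    step : ∀ L → (∀ {m} → m < L → Walk G allV x y m → ∃ λ d → IsDist G x y d) →
           Walk G allV x y L → ∃ λ d → IsDist G x y d
    step L shorter w with any? {n = L} (λ i → walk? (toℕ i) x y)
    ... | yes (i , wᵢ) = shorter (toℕ<n i) wᵢ
    ... | no ¬shorter  = L , w , λ k wₖ → ≮⇒≥ λ k<L →
            ¬shorter (fromℕ< k<L , subst (Walk G allV x y) (≡-sym (toℕ-fromℕ< k<L)) wₖ)

  isDist-unique : ∀ {x y d d′} → IsDist G x y d → IsDist G x y d′ → d ≡ d′
  isDist-unique (w , min) (w′ , min′) = ≤-antisym (min _ w′) (min′ _ w)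

  walk-exits-component : ∀ {P C} → Decidable P → IsComponent G P C →
    ∀ {x z k} → x ∈ C → z ∉ C → Walk G allV x z k →
    ∃ λ w → ¬ P w × ∃ λ a → ∃ λ b → a + b ≡ k × Walk G allV x w a × Walk G allV w z b
  walk-exits-component P? comp x∈C z∉C (nil _) = ⊥-elim (z∉C x∈C)
  walk-exits-component P? comp@(_ , C⊆P , _ , closed) {x} x∈C z∉C (cons {z = y} _ e rest)
    with P? y
  ... | no ¬Py = y , ¬Py , 1 , _ , refl , cons tt e (nil tt) , rest
  ... | yes Py with walk-exits-component P? comp (closed x y x∈C (1 , cons (C⊆P x x∈C) e (nil Py))) z∉C rest
  ...   | w , ¬Pw , a , b , a+b≡k , x⇝w , w⇝z = w , ¬Pw , suc a , b , cong suc a+b≡k , cons tt e x⇝w , w⇝z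

module WeisfeilerLeman {n : ℕ} (G : Graph n) where

  wlEq⇒atomEq : ∀ r {p q} → WLEq G r p q → AtomEq G p q
  wlEq⇒atomEq zero    p~q       = p~q
  wlEq⇒atomEq (suc r) (p~q , _) = wlEq⇒atomEq r p~q

  wlEq-sym : ∀ r {p q} → WLEq G r p q → WLEq G r q p
  wlEq-sym zero (same , adj≡) = mk⇔ (Equivalence.from same) (Equivalence.to same) , ≡-sym adj≡
  wlEq-sym (suc r) {v₁ , v₂} {w₁ , w₂} (p~q , π , match) = wlEq-sym r p~q , Perm.flip π , match⁻¹
    where
    match⁻¹ : ∀ x → WLEq G r (x , w₂) (Inverse.from π x , v₂) × WLEq G r (w₁ , x) (v₁ , Inverse.from π x)
    match⁻¹ x with match (Inverse.from π x)
    ... | left , right =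
      subst (λ t → WLEq G r (t , w₂) (Inverse.from π x , v₂)) (Perm.inverseʳ π) (wlEq-sym r left) ,
      subst (λ t → WLEq G r (w₁ , t) (v₁ , Inverse.from π x)) (Perm.inverseʳ π) (wlEq-sym r right)

  -- Stability lets each step of the walk be matched through the refinement bijection.
  stable-transports-walks : ∀ {r} → NotStrictlyFiner G r → ∀ {k a b c d} →
    WLEq G r (a , b) (c , d) → Walk G allV a b k → Walk G allV c d k
  stable-transports-walks {r} stable ab~cd (nil _)
    with Equivalence.to (proj₁ (wlEq⇒atomEq r ab~cd)) refl
  ... | refl = nil tt
  stable-transports-walks {r} stable ab~cd (cons {z = z} _ e w) with stable _ _ ab~cd
  ... | _ , π , match with match z
  ...   | zb~πzd , az~cπz =
    cons tt (subst (_≡ true) (proj₂ (wlEq⇒atomEq r az~cπz)) e) (stable-transports-walks stable zb~πzd w)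

  stable-preserves-isDist : ∀ {r} → NotStrictlyFiner G r → ∀ {d a b c e} →
    WLEq G r (a , b) (c , e) → IsDist G a b d → IsDist G c e d
  stable-preserves-isDist {r} stable ab~ce (w , min) =
    stable-transports-walks stable ab~ce w ,
    λ k w′ → min k (stable-transports-walks stable (wlEq-sym r ab~ce) w′)

module Distance {n : ℕ} (G : Graph n) (conn : Connected G) where

  open Walks G
  open WeisfeilerLeman G

  dist : Fin n → Fin n → ℕ
  dist x y = proj₁ (walk⇒isDist _ (proj₂ (conn x y)))

  dist-isDist : ∀ x y → IsDist G x y (dist x y)
  dist-isDist x y = proj₂ (walk⇒isDist _ (proj₂ (conn x y)))

  dist-walk : ∀ x y → Walk G allV x y (dist x y)
  dist-walk x y = proj₁ (dist-isDist x y)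

  dist-minimal : ∀ {x y k} → Walk G allV x y k → dist x y ≤ k
  dist-minimal {x} {y} = proj₂ (dist-isDist x y) _

  isDist⇒≡dist : ∀ {x y d} → IsDist G x y d → d ≡ dist x y
  isDist⇒≡dist {x} {y} isDist = isDist-unique isDist (dist-isDist x y)

  dist-triangle : ∀ x y z → dist x z ≤ dist x y + dist y z
  dist-triangle x y z = dist-minimal (dist-walk x y ++ʷ dist-walk y z)

  closer-outside-component : ∀ {P C} → Decidable P → IsComponent G P C → ∀ {u v k} → v ∈ C →
    (∀ w → ¬ P w → dist u w + k ≤ dist v w) → ∀ {z} → z ∉ C → dist u z + k ≤ dist v z
  closer-outside-component P? comp {u} {v} {k} v∈C closer {z} z∉C
    with walk-exits-component P? comp v∈C z∉C (dist-walk v z)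
  ... | w , ¬Pw , a , b , a+b≡dist , v⇝w , w⇝z = begin
    dist u z + k              ≤⟨ +-monoˡ-≤ k (dist-triangle u w z) ⟩
    dist u w + dist w z + k   ≡⟨ +-comm-middle (dist u w) (dist w z) k ⟩
    dist u w + k + dist w z   ≤⟨ +-mono-≤ (closer w ¬Pw) (dist-minimal w⇝z) ⟩
    dist v w + b              ≤⟨ +-monoˡ-≤ b (dist-minimal v⇝w) ⟩
    a + b                     ≡⟨ a+b≡dist ⟩
    dist v z                  ∎
    where
    open ≤-Reasoning
    +-comm-middle : ∀ a b c → a + b + c ≡ a + c + b
    +-comm-middle = solve-∀

  stable-distanceSum : ∀ {r} → NotStrictlyFiner G r → ∀ {a b c d} →
    WLEq G r (a , b) (c , d) → sum (dist a) ≡ sum (dist c)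
  stable-distanceSum stable ab~cd with stable _ _ ab~cd
  ... | _ , π , match = begin
    sum (dist _)                          ≡⟨ sum-cong-≗ dist-matched ⟩
    sum (λ x → dist _ (Inverse.to π x))   ≡⟨ ≡-sym (sum-permute (dist _) π) ⟩
    sum (dist _)                          ∎
    where
    open ≡-Reasoning
    dist-matched : ∀ x → dist _ x ≡ dist _ (Inverse.to π x)
    dist-matched x = isDist⇒≡dist (stable-preserves-isDist stable (proj₂ (match x)) (dist-isDist _ x))

sum-mono-≤ : ∀ {m} {f g : Fin m → ℕ} → (∀ i → f i ≤ g i) → sum f ≤ sum g
sum-mono-≤ {zero}  f≤g = z≤n
sum-mono-≤ {suc m} f≤g = +-mono-≤ (f≤g zero) (sum-mono-≤ (λ i → f≤g (suc i)))

sum-const : ∀ m k → sum {m} (λ _ → k) ≡ m * k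
sum-const zero    k = refl
sum-const (suc m) k = cong (k +_) (sum-const m k)

sum-indicator : ∀ {m} (C : Subset m) k → sum (λ z → if lookup C z then k else 0) ≡ ∣ C ∣ * k
sum-indicator []          k = refl
sum-indicator (true ∷ C)  k = cong (k +_) (sum-indicator C k)
sum-indicator (false ∷ C) k = sum-indicator C k

lookup≡false⇒∉ : ∀ {m} {C : Subset m} {z} → lookup C z ≡ false → z ∉ C
lookup≡false⇒∉ z-out z∈C with () ← trans (≡-sym ([]=⇒lookup z∈C)) z-out

sum-slack : ∀ {m} (f g h : Fin m → ℕ) k → sum f ≡ sum g →
  (∀ i → f i + k ≤ g i + h i) → m * k ≤ sum h
sum-slack {m} f g h k Σf≡Σg pointwise = +-cancelˡ-≤ (sum f) (m * k) (sum h) (begin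
  sum f + m * k                 ≡⟨ cong (sum f +_) (sum-const m k) ⟨
  sum f + sum {m} (λ _ → k)     ≡⟨ ∑-distrib-+ f (λ _ → k) ⟨
  sum (λ i → f i + k)           ≤⟨ sum-mono-≤ pointwise ⟩
  sum (λ i → g i + h i)         ≡⟨ ∑-distrib-+ g h ⟩
  sum g + sum h                 ≡⟨ cong (_+ sum h) Σf≡Σg ⟨
  sum f + sum h                 ∎)
  where open ≤-Reasoning

notIn? : ∀ {n} (w₁ w₂ : Fin n) → Decidable (notIn w₁ w₂)
notIn? w₁ w₂ x = ¬? (x Fin.≟ w₁) ×-dec ¬? (x Fin.≟ w₂)

¬notIn⇒≡ : ∀ {n} {w₁ w₂ x : Fin n} → ¬ notIn w₁ w₂ x → x ≡ w₁ ⊎ x ≡ w₂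
¬notIn⇒≡ {w₁ = w₁} {w₂} {x} ¬notIn with x Fin.≟ w₁ | x Fin.≟ w₂
... | yes x≡w₁ | _        = inj₁ x≡w₁
... | no _     | yes x≡w₂ = inj₂ x≡w₂
... | no x≢w₁  | no x≢w₂  = ⊥-elim (¬notIn (x≢w₁ , x≢w₂))

small-component-slack : ∀ c n → 2 * c + 2 ≤ n → c * 4 < n * 2
small-component-slack c n size = begin-strict
  c * 4                 <⟨ m<m+n (c * 4) {4} (s≤s z≤n) ⟩
  c * 4 + 4             ≡⟨ expand c ⟩
  (2 * c + 2) * 2       ≤⟨ *-monoˡ-≤ 2 size ⟩
  n * 2                 ∎
  where
  open ≤-Reasoning
  expand : ∀ c → c * 4 + 4 ≡ (2 * c + 2) * 2
  expand = solve-∀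

mainTheorem16 : {n : ℕ} (G : Graph n) → Connected G →
    (w₁ w₂ : Fin n) → TwoSeparator G w₁ w₂ →
    (C : Subset n) → IsComponent G (notIn w₁ w₂) C → 2 * ∣ C ∣ + 2 ≤ n →
    (v : Fin n) → v ∈ C →
    ¬ (Σ (Fin n) λ u →
        (∃ λ d → IsDist G u v d × d ≤ 2) ×
        SameStableColour G (u , u) (v , v) ×
        (∃ λ d₁ → ∃ λ e₁ → IsDist G u w₁ d₁ × IsDist G v w₁ e₁ × d₁ + 2 ≤ e₁) ×
        (∃ λ d₂ → ∃ λ e₂ → IsDist G u w₂ d₂ × IsDist G v w₂ e₂ × d₂ + 2 ≤ e₂))
mainTheorem16 {n} G conn w₁ w₂ _ C component size v v∈C
  (u , (d , u-v , d≤2) , (r , (stable , _) , uu~vv) ,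
       (_ , _ , u-w₁ , v-w₁ , closer₁) , (_ , _ , u-w₂ , v-w₂ , closer₂)) =
  <⇒≱ (small-component-slack ∣ C ∣ n size)
    (subst (n * 2 ≤_) (sum-indicator C 4)
      (sum-slack (dist u) (dist v) _ 2 (stable-distanceSum stable uu~vv) pointwise))
  where
  open Distance G conn

  closer-to-separator : ∀ w → ¬ notIn w₁ w₂ w → dist u w + 2 ≤ dist v w
  closer-to-separator w w∉G-S with ¬notIn⇒≡ w∉G-S
  ... | inj₁ refl = subst₂ (λ a b → a + 2 ≤ b) (isDist⇒≡dist u-w₁) (isDist⇒≡dist v-w₁) closer₁
  ... | inj₂ refl = subst₂ (λ a b → a + 2 ≤ b) (isDist⇒≡dist u-w₂) (isDist⇒≡dist v-w₂) closer₂

  pointwise : ∀ z → dist u z + 2 ≤ dist v z + (if lookup C z then 4 else 0)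
  pointwise z with lookup C z in z-in
  ... | true = begin
    dist u z + 2              ≤⟨ +-monoˡ-≤ 2 (dist-triangle u v z) ⟩
    dist u v + dist v z + 2   ≤⟨ +-monoˡ-≤ 2 (+-monoˡ-≤ (dist v z) (subst (_≤ 2) (isDist⇒≡dist u-v) d≤2)) ⟩
    2 + dist v z + 2          ≡⟨ cong (_+ 2) (+-comm 2 (dist v z)) ⟩
    dist v z + 2 + 2          ≡⟨ +-assoc (dist v z) 2 2 ⟩
    dist v z + 4              ∎
    where open ≤-Reasoning
  ... | false = subst (dist u z + 2 ≤_) (≡-sym (+-identityʳ (dist v z)))
    (closer-outside-component (notIn? w₁ w₂) component v∈C closer-to-separator (lookup≡false⇒∉ z-in))
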